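{- For each integer $n\ge 1$ and each $1\le k<n$, $$S^B_q(n,k)=S^B_q(n-1,k-1)+[2k+1]_q\, S^B_q(n-1,k),$$ and moreover $S^B_q(n,0)=S^B_q(n,n)=1$ for all $n\ge1$.
   Context: For an integer $m\ge 0$, $[m]_q=1+q+\cdots+q^{m-1}$ (with $[0]_q=0$). A restricted growth word of type $B$ of the second kind of length $n$ is a word $\omega=\omega_1\cdots\omega_n$ with letters in $\{0,\pm1,\dots,\pm n\}$ such that, writing $M_{t-1}=\max\{0,|\omega_1|,\dots,|\omega_{t-1}|\}$ (so $M_0=0$), for every $1\le t\le n$ either $|\omega_t|\le M_{t-1}$ or $\omega_t=M_{t-1}+1$ (in particular $\omega_1\in\{0,1\}$, and a value whose absolute value appears for the first time must appear positive). Let $R^B_{(ii)}(n,k)$ be the set of such words with $\max_t|\omega_t|=k$. The weight of $\omega$ is $\mathrm{wt}(\omega)=\prod_{t=1}^n \mathrm{wt}_t(\omega)$, where $\mathrm{wt}_t(\omega)=1$ if $\omega_t=0$ or $\omega_t=M_{t-1}+1$; $\mathrm{wt}_t(\omega)=q^{2|\omega_t|-1}$ if $|\omega_t|\le M_{t-1}$ and $\omega_t<0$; and $\mathrm{wt}_t(\omega)=q^{2\omega_t}$ if $1\le\omega_t\le M_{t-1}$. Define $S^B_q(n,k)=\sum_{\omega\in R^B_{(ii)}(n,k)}\mathrm{wt}(\omega)$. (These words are in bijection with signed set partitions of $[n]$ with $k$ non-zero block pairs.) -}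

module Defs where

open import Level using (Level)
open import Algebra.Bundles using (CommutativeSemiring)
open import Data.Nat using (ℕ; zero; suc; _≤ᵇ_; _≡ᵇ_) renaming (_+_ to _+ℕ_; _*_ to _*ℕ_; _∸_ to _∸ℕ_)
open import Data.Integer using (ℤ; +_; -[1+_])
open import Data.List using (List; []; _∷_; map; concatMap; foldr)
open import Data.Maybe using (Maybe; just; nothing)
open import Data.Product using (_×_; _,_)
open import Data.Bool using (Bool; true; false; if_then_else_)

letters : ℕ → List ℤ
letters zero    = + 0 ∷ []
letters (suc n) = + (suc n) ∷ -[1+ n ] ∷ letters n

allWords : ℕ → ℕ → List (List ℤ)
allWords a zero    = [] ∷ []
allWords a (suc m) = concatMap (λ x → map (x ∷_) (allWords a m)) (letters a)

module _ {c ℓ : Level} (R : CommutativeSemiring c ℓ) where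
  open CommutativeSemiring R

  pow : Carrier → ℕ → Carrier
  pow q zero    = 1#
  pow q (suc e) = q * pow q e

  qint : Carrier → ℕ → Carrier
  qint q zero    = 0#
  qint q (suc m) = pow q m + qint q m

  -- Scan a word from left to right, with current running maximum M
  -- (M_{t-1}).  Returns nothing if the word violates the restricted growth
  -- condition, otherwise  just (final maximum, weight of the remaining part).
  scan : Carrier → ℕ → List ℤ → Maybe (ℕ × Carrier)
  scan q M [] = just (M , 1#)
  scan q M (+ zero ∷ w) = scan q M w
  scan q M (+ suc a ∷ w) =
    if a ≡ᵇ M
      then mult 1# (scan q (suc M) w)                    -- ω_t = M_{t-1}+1 (new value)
      else (if suc a ≤ᵇ M
              then mult (pow q (2 *ℕ suc a)) (scan q M w)
              else nothing)
    where
      mult : Carrier → Maybe (ℕ × Carrier) → Maybe (ℕ × Carrier)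
      mult y nothing        = nothing
      mult y (just (k , x)) = just (k , y * x)
  scan q M (-[1+ a ] ∷ w) =
    if suc a ≤ᵇ M
      then mult (pow q ((2 *ℕ suc a) ∸ℕ 1)) (scan q M w)
      else nothing
    where
      mult : Carrier → Maybe (ℕ × Carrier) → Maybe (ℕ × Carrier)
      mult y nothing        = nothing
      mult y (just (k , x)) = just (k , y * x)

  contrib : Carrier → ℕ → List ℤ → Carrier
  contrib q k w with scan q 0 w
  ... | nothing       = 0#
  ... | just (m , x)  = if m ≡ᵇ k then x else 0#

  SB : Carrier → ℕ → ℕ → Carrier
  SB q n k = foldr (λ w acc → contrib q k w + acc) 0# (allWords n n)

-- Let W(m, M, k) be the total weight of the words of length m that, read from running
-- maximum M, end with maximum k.  Splitting off the first letter: the 2M+1 letters of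
-- absolute value at most M keep the maximum and together carry weight
-- 1 + (q + q²) + ... + (q^(2M-1) + q^(2M)) = [2M+1]_q, the letter M+1 raises the maximum,
-- and every other letter is invalid.  Hence, for any alphabet containing M+m,
--   W(m+1, M, k) = [2M+1]_q W(m, M, k) + W(m, M+1, k),
-- which is the recursion defining SBfrom, and SB n k = W(n, 0, k).  The recurrence of the
-- theorem is the decomposition by the last letter instead; it follows from the
-- first-letter recursion by induction on m.
module Submission where

open import Defs
open import Level using (Level)
open import Algebra.Bundles using (CommutativeSemiring)
open import Data.Nat using (ℕ; zero; suc; _≤_; _<_; _∸_; _+_; _*_; _≡ᵇ_; _≤ᵇ_; s≤s)
open import Data.Nat.Properties as ℕ
  using (≡ᵇ⇒≡; ≡⇒≡ᵇ; ≤ᵇ⇒≤; ≤⇒≤ᵇ; *-suc; +-suc; m≤n⇒m<n∨m≡n; <⇒≢; <⇒≱;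
         ≤-refl; ≤-trans; ≤-reflexive; n≤1+n; m≤n⇒m≤1+n; m+n≤o⇒m≤o; <-trans; +-monoʳ-<; n<1+n)
open import Data.Integer using (ℤ; +_; -[1+_])
open import Data.List using (List; []; _∷_; map; concatMap; foldr; _++_)
open import Data.Maybe using (Maybe; just; nothing)
open import Data.Product using (_×_; _,_)
open import Data.Bool using (Bool; true; false; if_then_else_; T)
open import Data.Bool.Properties using (T-≡)
open import Data.Sum using (inj₁; inj₂)
open import Data.Empty using (⊥-elim)
open import Function.Bundles using (Equivalence)
open import Relation.Nullary using (¬_)
open import Relation.Binary.PropositionalEquality as ≡ using (_≡_)
import Relation.Binary.Reasoning.Setoid as SetoidReasoning
import Algebra.Properties.CommutativeSemigroup as CommSemigroupProperties

T⇒≡true : ∀ {b} → T b → b ≡ true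
T⇒≡true = Equivalence.to T-≡

¬T⇒≡false : ∀ {b} → ¬ T b → b ≡ false
¬T⇒≡false {true}  ¬t = ⊥-elim (¬t _)
¬T⇒≡false {false} _  = ≡.refl

module SemiringFacts {c ℓ : Level} (R : CommutativeSemiring c ℓ) where
  open CommutativeSemiring R renaming (_+_ to _⊕_; _*_ to _⊗_) hiding (zero)

  ∑ : {A : Set} → List A → (A → Carrier) → Carrier
  ∑ xs f = foldr (λ x acc → f x ⊕ acc) 0# xs

  ∑-cong : {A : Set} (xs : List A) {f g : A → Carrier} → (∀ x → f x ≈ g x) → ∑ xs f ≈ ∑ xs g
  ∑-cong []       f≈g = refl
  ∑-cong (x ∷ xs) f≈g = +-cong (f≈g x) (∑-cong xs f≈g)

  ∑-zero : {A : Set} (xs : List A) {f : A → Carrier} → (∀ x → f x ≈ 0#) → ∑ xs f ≈ 0#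
  ∑-zero []       f≈0 = refl
  ∑-zero (x ∷ xs) f≈0 = trans (+-cong (f≈0 x) (∑-zero xs f≈0)) (+-identityˡ 0#)

  ∑-++ : {A : Set} (xs ys : List A) (f : A → Carrier) → ∑ (xs ++ ys) f ≈ ∑ xs f ⊕ ∑ ys f
  ∑-++ []       ys f = sym (+-identityˡ _)
  ∑-++ (x ∷ xs) ys f = trans (+-cong refl (∑-++ xs ys f)) (sym (+-assoc _ _ _))

  ∑-map : {A B : Set} (xs : List A) (h : A → B) (f : B → Carrier) → ∑ (map h xs) f ≈ ∑ xs (λ x → f (h x))
  ∑-map []       h f = refl
  ∑-map (x ∷ xs) h f = +-cong refl (∑-map xs h f)

  ∑-concatMap : {A B : Set} (xs : List A) (g : A → List B) (f : B → Carrier) →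
                ∑ (concatMap g xs) f ≈ ∑ xs (λ x → ∑ (g x) f)
  ∑-concatMap []       g f = refl
  ∑-concatMap (x ∷ xs) g f = trans (∑-++ (g x) (concatMap g xs) f) (+-cong refl (∑-concatMap xs g f))

  ∑-*ˡ : {A : Set} (xs : List A) (y : Carrier) (f : A → Carrier) → ∑ xs (λ x → y ⊗ f x) ≈ y ⊗ ∑ xs f
  ∑-*ˡ []       y f = sym (zeroʳ y)
  ∑-*ˡ (x ∷ xs) y f = trans (+-cong refl (∑-*ˡ xs y f)) (sym (distribˡ y _ _))

  if-*ˡ : ∀ (b : Bool) y x → (if b then y ⊗ x else 0#) ≈ y ⊗ (if b then x else 0#)
  if-*ˡ true  y x = refl
  if-*ˡ false y x = sym (zeroʳ y)

  pow-congˡ : ∀ {x y} n → x ≈ y → pow R x n ≈ pow R y n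
  pow-congˡ zero    x≈y = refl
  pow-congˡ (suc n) x≈y = *-cong x≈y (pow-congˡ n x≈y)

  pow-1# : ∀ n → pow R 1# n ≈ 1#
  pow-1# zero    = refl
  pow-1# (suc n) = trans (*-identityˡ _) (pow-1# n)

  qint-odd-suc : ∀ q j → qint R q (2 * suc j + 1) ≡ pow R q (2 * suc j) ⊕ (pow R q (2 * suc j ∸ 1) ⊕ qint R q (2 * j + 1))
  qint-odd-suc q j = split (2 * suc j) (2 * j + 1) 2+2j≡1+[2j+1]
    where
      2+2j≡1+[2j+1] : 2 * suc j ≡ suc (2 * j + 1)
      2+2j≡1+[2j+1] = ≡.trans (*-suc 2 j) (≡.cong suc (ℕ.+-comm 1 (2 * j)))

      split : ∀ s t → s ≡ suc t → qint R q (s + 1) ≡ pow R q s ⊕ (pow R q (s ∸ 1) ⊕ qint R q t)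
      split _ t ≡.refl rewrite ℕ.+-comm t 1 = ≡.refl

module Words {c ℓ : Level} (R : CommutativeSemiring c ℓ) (q : CommutativeSemiring.Carrier R) where
  open CommutativeSemiring R renaming (_+_ to _⊕_; _*_ to _⊗_) hiding (zero)
  open SetoidReasoning setoid
  open SemiringFacts R

  weightAt : ℕ → Maybe (ℕ × Carrier) → Carrier
  weightAt k nothing        = 0#
  weightAt k (just (m , x)) = if m ≡ᵇ k then x else 0#

  contrib≡weightAt-scan : ∀ k w → contrib R q k w ≡ weightAt k (scan R q 0 w)
  contrib≡weightAt-scan k w with scan R q 0 w
  ... | nothing = ≡.refl
  ... | just _  = ≡.refl

  wordSum : ℕ → ℕ → ℕ → ℕ → Carrier
  wordSum a m M k = ∑ (allWords a m) (λ w → weightAt k (scan R q M w))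

  SB≈wordSum : ∀ n k → SB R q n k ≈ wordSum n n 0 k
  SB≈wordSum n k = ∑-cong (allWords n n) (λ w → reflexive (contrib≡weightAt-scan k w))

  module _ (k M : ℕ) (w : List ℤ) where
    weightAt-fresh : weightAt k (scan R q M (+ suc M ∷ w)) ≈ weightAt k (scan R q (suc M) w)
    weightAt-fresh rewrite T⇒≡true (≡⇒≡ᵇ M M ≡.refl) with scan R q (suc M) w
    ... | nothing       = refl
    ... | just (m , x)  = trans (if-*ˡ (m ≡ᵇ k) 1# x) (*-identityˡ _)

    weightAt-old⁺ : ∀ {j} → j < M → weightAt k (scan R q M (+ suc j ∷ w)) ≈ pow R q (2 * suc j) ⊗ weightAt k (scan R q M w)
    weightAt-old⁺ {j} j<M rewrite ¬T⇒≡false {j ≡ᵇ M} (λ t → <⇒≢ j<M (≡ᵇ⇒≡ j M t)) | T⇒≡true (≤⇒≤ᵇ j<M) with scan R q M w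
    ... | nothing       = sym (zeroʳ _)
    ... | just (m , x)  = if-*ˡ (m ≡ᵇ k) _ x

    weightAt-old⁻ : ∀ {j} → j < M → weightAt k (scan R q M (-[1+ j ] ∷ w)) ≈ pow R q (2 * suc j ∸ 1) ⊗ weightAt k (scan R q M w)
    weightAt-old⁻ j<M rewrite T⇒≡true (≤⇒≤ᵇ j<M) with scan R q M w
    ... | nothing       = sym (zeroʳ _)
    ... | just (m , x)  = if-*ˡ (m ≡ᵇ k) _ x

    weightAt-invalid⁺ : ∀ {j} → M < j → weightAt k (scan R q M (+ suc j ∷ w)) ≈ 0#
    weightAt-invalid⁺ {j} M<j
      rewrite ¬T⇒≡false {j ≡ᵇ M} (λ t → <⇒≢ M<j (≡.sym (≡ᵇ⇒≡ j M t)))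
            | ¬T⇒≡false {suc j ≤ᵇ M} (λ t → <⇒≱ M<j (≤-trans (n≤1+n j) (≤ᵇ⇒≤ (suc j) M t))) = refl

    weightAt-invalid⁻ : ∀ {j} → M ≤ j → weightAt k (scan R q M (-[1+ j ] ∷ w)) ≈ 0#
    weightAt-invalid⁻ {j} M≤j rewrite ¬T⇒≡false {suc j ≤ᵇ M} (λ t → <⇒≱ (≤ᵇ⇒≤ (suc j) M t) M≤j) = refl

  module FirstLetter (W : List (List ℤ)) (M k : ℕ) where
    withFirst : ℤ → Carrier
    withFirst x = ∑ W (λ w → weightAt k (scan R q M (x ∷ w)))

    stay raise : Carrier
    stay  = ∑ W (λ w → weightAt k (scan R q M w))
    raise = ∑ W (λ w → weightAt k (scan R q (suc M) w))

    ∑letters-old : ∀ j → j ≤ M → ∑ (letters j) withFirst ≈ qint R q (2 * j + 1) ⊗ stay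
    ∑letters-old zero _ = begin
      stay ⊕ 0#         ≈⟨ +-identityʳ stay ⟩
      stay              ≈⟨ *-identityˡ stay ⟨
      1# ⊗ stay         ≈⟨ *-congʳ (+-identityʳ 1#) ⟨
      (1# ⊕ 0#) ⊗ stay  ∎
    ∑letters-old (suc j) j<M = begin
      withFirst (+ suc j) ⊕ (withFirst -[1+ j ] ⊕ ∑ (letters j) withFirst)
        ≈⟨ +-cong (trans (∑-cong W (λ w → weightAt-old⁺ k M w j<M)) (∑-*ˡ W _ _))
                  (+-cong (trans (∑-cong W (λ w → weightAt-old⁻ k M w j<M)) (∑-*ˡ W _ _))
                          (∑letters-old j (≤-trans (n≤1+n j) j<M))) ⟩
      qᵉ ⊗ stay ⊕ (qᵒ ⊗ stay ⊕ qint R q (2 * j + 1) ⊗ stay)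
        ≈⟨ +-cong refl (distribʳ stay _ _) ⟨
      qᵉ ⊗ stay ⊕ (qᵒ ⊕ qint R q (2 * j + 1)) ⊗ stay
        ≈⟨ distribʳ stay _ _ ⟨
      (qᵉ ⊕ (qᵒ ⊕ qint R q (2 * j + 1))) ⊗ stay
        ≈⟨ *-congʳ (reflexive (qint-odd-suc q j)) ⟨
      qint R q (2 * suc j + 1) ⊗ stay ∎
      where
        qᵉ = pow R q (2 * suc j)
        qᵒ = pow R q (2 * suc j ∸ 1)

    ∑letters : ∀ a → M < a → ∑ (letters a) withFirst ≈ qint R q (2 * M + 1) ⊗ stay ⊕ raise
    ∑letters (suc a) (s≤s M≤a) with m≤n⇒m<n∨m≡n M≤a
    ... | inj₂ ≡.refl = begin
      withFirst (+ suc M) ⊕ (withFirst -[1+ M ] ⊕ ∑ (letters M) withFirst)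
        ≈⟨ +-cong (∑-cong W (weightAt-fresh k M))
                  (+-cong (∑-zero W (λ w → weightAt-invalid⁻ k M w ≤-refl)) (∑letters-old M ≤-refl)) ⟩
      raise ⊕ (0# ⊕ qint R q (2 * M + 1) ⊗ stay)  ≈⟨ +-cong refl (+-identityˡ _) ⟩
      raise ⊕ qint R q (2 * M + 1) ⊗ stay         ≈⟨ +-comm _ _ ⟩
      qint R q (2 * M + 1) ⊗ stay ⊕ raise         ∎
    ... | inj₁ M<a = begin
      withFirst (+ suc a) ⊕ (withFirst -[1+ a ] ⊕ ∑ (letters a) withFirst)
        ≈⟨ +-cong (∑-zero W (λ w → weightAt-invalid⁺ k M w M<a))
                  (+-cong (∑-zero W (λ w → weightAt-invalid⁻ k M w M≤a)) (∑letters a M<a)) ⟩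
      0# ⊕ (0# ⊕ (qint R q (2 * M + 1) ⊗ stay ⊕ raise))  ≈⟨ trans (+-identityˡ _) (+-identityˡ _) ⟩
      qint R q (2 * M + 1) ⊗ stay ⊕ raise               ∎

  open FirstLetter using (∑letters)

  SBfrom : ℕ → ℕ → ℕ → Carrier
  SBfrom zero    M k = if M ≡ᵇ k then 1# else 0#
  SBfrom (suc m) M k = qint R q (2 * M + 1) ⊗ SBfrom m M k ⊕ SBfrom m (suc M) k

  wordSum≈SBfrom : ∀ a m M k → M + m ≤ a → wordSum a m M k ≈ SBfrom m M k
  wordSum≈SBfrom a zero    M k _  = +-identityʳ _
  wordSum≈SBfrom a (suc m) M k M+1+m≤a = begin
    wordSum a (suc m) M k
      ≈⟨ ∑-concatMap (letters a) (λ x → map (x ∷_) (allWords a m)) _ ⟩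
    ∑ (letters a) (λ x → ∑ (map (x ∷_) (allWords a m)) (λ w → weightAt k (scan R q M w)))
      ≈⟨ ∑-cong (letters a) (λ x → ∑-map (allWords a m) (x ∷_) _) ⟩
    ∑ (letters a) (FirstLetter.withFirst (allWords a m) M k)
      ≈⟨ ∑letters (allWords a m) M k a (m+n≤o⇒m≤o (suc M) le′) ⟩
    qint R q (2 * M + 1) ⊗ wordSum a m M k ⊕ wordSum a m (suc M) k
      ≈⟨ +-cong (*-congˡ (wordSum≈SBfrom a m M k (≤-trans (n≤1+n (M + m)) le′)))
                (wordSum≈SBfrom a m (suc M) k le′) ⟩
    SBfrom (suc m) M k ∎
    where
      le′ : suc M + m ≤ a
      le′ = ≤-trans (≤-reflexive (≡.sym (+-suc M m))) M+1+m≤a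

  SB≈SBfrom : ∀ n k → SB R q n k ≈ SBfrom n 0 k
  SB≈SBfrom n k = trans (SB≈wordSum n k) (wordSum≈SBfrom n n 0 k ≤-refl)

  SBfrom-below : ∀ m M k → k < M → SBfrom m M k ≈ 0#
  SBfrom-below zero    M k k<M rewrite ¬T⇒≡false {M ≡ᵇ k} (λ t → <⇒≢ k<M (≡.sym (≡ᵇ⇒≡ M k t))) = refl
  SBfrom-below (suc m) M k k<M =
    trans (+-cong (trans (*-congˡ (SBfrom-below m M k k<M)) (zeroʳ _)) (SBfrom-below m (suc M) k (m≤n⇒m≤1+n k<M)))
          (+-identityˡ 0#)

  SBfrom-above : ∀ m M k → M + m < k → SBfrom m M k ≈ 0#
  SBfrom-above zero    M k M+0<k rewrite ¬T⇒≡false {M ≡ᵇ k} (λ t → <⇒≢ M+0<k (≡.trans (ℕ.+-identityʳ M) (≡ᵇ⇒≡ M k t))) = refl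
  SBfrom-above (suc m) M k M+1+m<k =
    trans (+-cong (trans (*-congˡ (SBfrom-above m M k (<-trans (+-monoʳ-< M (n<1+n m)) M+1+m<k))) (zeroʳ _))
                  (SBfrom-above m (suc M) k (≤-trans (≤-reflexive (≡.cong suc (≡.sym (+-suc M m)))) M+1+m<k)))
          (+-identityˡ 0#)

  SBfrom-diagonal : ∀ m M → SBfrom m M M ≈ pow R (qint R q (2 * M + 1)) m
  SBfrom-diagonal zero    M rewrite T⇒≡true (≡⇒≡ᵇ M M ≡.refl) = refl
  SBfrom-diagonal (suc m) M =
    trans (+-cong (*-congˡ (SBfrom-diagonal m M)) (SBfrom-below m (suc M) M (n<1+n M))) (+-identityʳ _)

  SBfrom-top : ∀ m M → SBfrom m M (M + m) ≈ 1#
  SBfrom-top zero    M rewrite T⇒≡true (≡⇒≡ᵇ M (M + 0) (≡.sym (ℕ.+-identityʳ M))) = refl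
  SBfrom-top (suc m) M = begin
    qint R q (2 * M + 1) ⊗ SBfrom m M (M + suc m) ⊕ SBfrom m (suc M) (M + suc m)
      ≈⟨ +-cong (trans (*-congˡ (SBfrom-above m M (M + suc m) (+-monoʳ-< M (n<1+n m)))) (zeroʳ _))
                (reflexive (≡.cong (SBfrom m (suc M)) (+-suc M m))) ⟩
    0# ⊕ SBfrom m (suc M) (suc M + m)  ≈⟨ trans (+-identityˡ _) (SBfrom-top m (suc M)) ⟩
    1#                                 ∎

  SBfrom-last-letter : ∀ m M k →
    SBfrom (suc m) M (suc k) ≈ SBfrom m M k ⊕ qint R q (2 * suc k + 1) ⊗ SBfrom m M (suc k)
  SBfrom-last-letter zero M k with M ≡ᵇ suc k in eq
  ... | true rewrite ≡ᵇ⇒≡ M (suc k) (≡.subst T (≡.sym eq) _) = +-comm _ _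
  ... | false = begin
    qint R q (2 * M + 1) ⊗ 0# ⊕ SBfrom zero (suc M) (suc k)  ≈⟨ +-cong (zeroʳ _) refl ⟩
    0# ⊕ SBfrom zero M k                                    ≈⟨ +-comm _ _ ⟩
    SBfrom zero M k ⊕ 0#                                    ≈⟨ +-cong refl (zeroʳ _) ⟨
    SBfrom zero M k ⊕ qint R q (2 * suc k + 1) ⊗ 0#          ∎
  SBfrom-last-letter (suc m) M k = begin
    a ⊗ SBfrom (suc m) M (suc k) ⊕ SBfrom (suc m) (suc M) (suc k)
      ≈⟨ +-cong (*-congˡ (SBfrom-last-letter m M k)) (SBfrom-last-letter m (suc M) k) ⟩
    a ⊗ (x ⊕ b ⊗ y) ⊕ (x′ ⊕ b ⊗ y′)
      ≈⟨ +-cong (distribˡ a _ _) refl ⟩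
    (a ⊗ x ⊕ a ⊗ (b ⊗ y)) ⊕ (x′ ⊕ b ⊗ y′)
      ≈⟨ +-cong (+-cong refl (CommSemigroupProperties.x∙yz≈y∙xz *-commutativeSemigroup a b y)) refl ⟩
    (a ⊗ x ⊕ b ⊗ (a ⊗ y)) ⊕ (x′ ⊕ b ⊗ y′)
      ≈⟨ CommSemigroupProperties.interchange +-commutativeSemigroup _ _ _ _ ⟩
    (a ⊗ x ⊕ x′) ⊕ (b ⊗ (a ⊗ y) ⊕ b ⊗ y′)
      ≈⟨ +-cong refl (distribˡ b _ _) ⟨
    SBfrom (suc m) M k ⊕ b ⊗ SBfrom (suc m) M (suc k) ∎
    where
      a  = qint R q (2 * M + 1)
      b  = qint R q (2 * suc k + 1)
      x  = SBfrom m M k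
      y  = SBfrom m M (suc k)
      x′ = SBfrom m (suc M) k
      y′ = SBfrom m (suc M) (suc k)

proposition3p7 : {c ℓ : Level} (R : CommutativeSemiring c ℓ) (q : CommutativeSemiring.Carrier R) →
    ((n k : ℕ) → 1 ≤ n → 1 ≤ k → k < n →
      CommutativeSemiring._≈_ R (SB R q n k)
        (CommutativeSemiring._+_ R (SB R q (n ∸ 1) (k ∸ 1))
          (CommutativeSemiring._*_ R (qint R q (2 * k + 1)) (SB R q (n ∸ 1) k))))
    × ((n : ℕ) → 1 ≤ n →
      CommutativeSemiring._≈_ R (SB R q n 0) (CommutativeSemiring.1# R)
        × CommutativeSemiring._≈_ R (SB R q n n) (CommutativeSemiring.1# R))
proposition3p7 R q = recurrence , boundary
  where
    open CommutativeSemiring R renaming (_+_ to _⊕_; _*_ to _⊗_) hiding (zero)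
    open SemiringFacts R using (pow-congˡ; pow-1#)
    open Words R q

    recurrence : (n k : ℕ) → 1 ≤ n → 1 ≤ k → k < n →
      SB R q n k ≈ SB R q (n ∸ 1) (k ∸ 1) ⊕ qint R q (2 * k + 1) ⊗ SB R q (n ∸ 1) k
    recurrence (suc n) (suc k) _ _ _ = begin
      SB R q (suc n) (suc k)                                              ≈⟨ SB≈SBfrom (suc n) (suc k) ⟩
      SBfrom (suc n) 0 (suc k)                                            ≈⟨ SBfrom-last-letter n 0 k ⟩
      SBfrom n 0 k ⊕ qint R q (2 * suc k + 1) ⊗ SBfrom n 0 (suc k)        ≈⟨ +-cong (SB≈SBfrom n k) (*-congˡ (SB≈SBfrom n (suc k))) ⟨
      SB R q n k ⊕ qint R q (2 * suc k + 1) ⊗ SB R q n (suc k)            ∎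
      where open SetoidReasoning setoid

    boundary : (n : ℕ) → 1 ≤ n → SB R q n 0 ≈ 1# × SB R q n n ≈ 1#
    boundary n _ =
      trans (SB≈SBfrom n 0) (trans (SBfrom-diagonal n 0) (trans (pow-congˡ n (+-identityʳ 1#)) (pow-1# n))) ,
      trans (SB≈SBfrom n n) (SBfrom-top n 0)
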